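{- Let $n = 2k-1$ be an odd positive integer, let $A = [0;n-1]^2$, let $G$ be the king graph on $A$, and let $P$ be any snake path in $G$. For every block $\beta$ of $G$, let $w(\beta)$ be the number of odd cells of $P$ that are vertices of $\beta$ plus the number of regular edges of $P$ that are edges of $\beta$. Then $w(\beta)\le 1$ when $\beta$ is a little block and $w(\beta)\le 2$ when $\beta$ is a large block.
   Context: King graph: distinct cells $(x',y'),(x'',y'')$ adjacent iff $|x'-x''|\le1$ and $|y'-y''|\le1$. Snake path: path which is an induced subgraph. A cell $(x,y)$ is even if $x,y$ are both even and odd if both are odd. An edge of $G$ is regular if it is not incident with an odd cell. Symmetries of $A$ are the eight isometries of the plane preserving $A$. For an even cell $a=(z,z)$ with $z\le k-2$, let $\beta(a)$ be the subgraph of $G$ with vertex set $a+[0;1]^2$ and edges joining $a$, $a+(0,1)$, $a+(1,0)$ pairwise (three edges); a little block is any image $\pi(\beta(a))$ of such a subgraph under a symmetry $\pi$ of $A$. For an even cell $a=(x,y)$ with $x>y$ and $x+y\le n-3$, let $\beta(a)$ be the subgraph with vertex set $a+[-1;1]\times[0;2]$ whose edges join $a$ to $a+(-1,0)$ and to $a+(1,0)$, and join $a+(0,1)$ to each of the six cells of $a+[-1;1]\times\{0,2\}$ (eight edges); a large block is any image of such a subgraph under a symmetry of $A$. A block is a little or a large block. -}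

module Defs where

open import Data.Nat using (ℕ; zero; suc; _+_; _*_; _∸_; _≤_; _<_; _%_; ∣_-_∣)
open import Data.Nat.Properties using (_≟_)
open import Data.Bool using (Bool; true; false; if_then_else_)
open import Data.Product using (_×_; _,_)
open import Data.Product.Properties using (≡-dec)
open import Data.Sum using (_⊎_)
open import Data.List using (List; []; _∷_; length; lookup; filter; map)
open import Data.List.Relation.Unary.All using (All)
open import Data.List.Relation.Unary.Unique.Propositional using (Unique)
open import Data.List.Membership.DecPropositional using () renaming (_∈?_ to mem?)
open import Data.List.Membership.Propositional using (_∈_)
open import Data.Fin using (Fin; toℕ)
open import Relation.Nullary using (¬_; Dec)
open import Relation.Nullary.Decidable using (_×-dec_; _⊎-dec_; ¬?)
open import Relation.Binary.PropositionalEquality using (_≡_; _≢_)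
open import Relation.Binary.Definitions using (DecidableEquality)

-- Cells of the plane grid (coordinates in ℕ; A = [0;n-1]^2 is cut out by InA)
Cell : Set
Cell = ℕ × ℕ

Edge : Set
Edge = Cell × Cell

_≟c_ : DecidableEquality Cell
_≟c_ = ≡-dec _≟_ _≟_

_≟e_ : DecidableEquality Edge
_≟e_ = ≡-dec _≟c_ _≟c_

InA : ℕ → Cell → Set
InA n (x , y) = x < n × y < n

Adj : Cell → Cell → Set
Adj (x , y) (x' , y') = (x , y) ≢ (x' , y') × ∣ x - x' ∣ ≤ 1 × ∣ y - y' ∣ ≤ 1

EvenCell : Cell → Set
EvenCell (x , y) = x % 2 ≡ 0 × y % 2 ≡ 0

OddCell : Cell → Set
OddCell (x , y) = x % 2 ≡ 1 × y % 2 ≡ 1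

oddCell? : (c : Cell) → Dec (OddCell c)
oddCell? (x , y) = (x % 2 ≟ 1) ×-dec (y % 2 ≟ 1)

Regular : Edge → Set
Regular (u , v) = ¬ OddCell u × ¬ OddCell v

regular? : (e : Edge) → Dec (Regular e)
regular? (u , v) = ¬? (oddCell? u) ×-dec ¬? (oddCell? v)

-- Snake path in the king graph on A = [0;n-1]^2, given as its vertex sequence:
-- vertices in A, pairwise distinct, and two vertices of P are adjacent in G
-- iff they are consecutive on P (path + induced subgraph).
record SnakePath (n : ℕ) (P : List Cell) : Set where
  field
    inA      : All (InA n) P
    distinct : Unique P
    consec⇒adj : (i j : Fin (length P)) → toℕ j ≡ suc (toℕ i) →
                 Adj (lookup P i) (lookup P j)
    adj⇒consec : (i j : Fin (length P)) → Adj (lookup P i) (lookup P j) →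
                 toℕ j ≡ suc (toℕ i) ⊎ toℕ i ≡ suc (toℕ j)

pathEdges : List Cell → List Edge
pathEdges (a ∷ b ∷ r) = (a , b) ∷ pathEdges (b ∷ r)
pathEdges _ = []

EdgeOf : List Cell → Edge → Set
EdgeOf P (u , v) = (u , v) ∈ pathEdges P ⊎ (v , u) ∈ pathEdges P

edgeOf? : (P : List Cell) → (e : Edge) → Dec (EdgeOf P e)
edgeOf? P (u , v) = mem? _≟e_ (u , v) (pathEdges P) ⊎-dec mem? _≟e_ (v , u) (pathEdges P)

record Subgraph : Set where
  constructor sg
  field
    verts : List Cell
    edges : List Edge

record Sym : Set where
  constructor sym
  field
    swap flipX flipY : Bool

applySym : ℕ → Sym → Cell → Cell
applySym n (sym s fx fy) (x , y) = step (if s then (y , x) else (x , y))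
  where
    m = n ∸ 1
    step : Cell → Cell
    step (x' , y') = (if fx then m ∸ x' else x') , (if fy then m ∸ y' else y')

imageSG : ℕ → Sym → Subgraph → Subgraph
imageSG n π (sg vs es) =
  sg (map (applySym n π) vs) (map (λ { (u , v) → applySym n π u , applySym n π v }) es)

littleβ : ℕ → Subgraph
littleβ z = sg ((z , z) ∷ (z , suc z) ∷ (suc z , z) ∷ (suc z , suc z) ∷ [])
               (((z , z) , (z , suc z)) ∷ ((z , z) , (suc z , z)) ∷ ((z , suc z) , (suc z , z)) ∷ [])

-- β(a) for a large block, a = (x,y) with x ≥ 1
largeβ : ℕ → ℕ → Subgraph
largeβ x y =
  sg ((x ∸ 1 , y) ∷ (x , y) ∷ (x + 1 , y) ∷
      (x ∸ 1 , y + 1) ∷ (x , y + 1) ∷ (x + 1 , y + 1) ∷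
      (x ∸ 1 , y + 2) ∷ (x , y + 2) ∷ (x + 1 , y + 2) ∷ [])
     (((x , y) , (x ∸ 1 , y)) ∷ ((x , y) , (x + 1 , y)) ∷
      ((x , y + 1) , (x ∸ 1 , y)) ∷ ((x , y + 1) , (x , y)) ∷ ((x , y + 1) , (x + 1 , y)) ∷
      ((x , y + 1) , (x ∸ 1 , y + 2)) ∷ ((x , y + 1) , (x , y + 2)) ∷ ((x , y + 1) , (x + 1 , y + 2)) ∷ [])

weight : List Cell → Subgraph → ℕ
weight P (sg vs es) =
  length (filter (λ c → oddCell? c ×-dec mem? _≟c_ c P) vs)
  + length (filter (λ e → regular? e ×-dec edgeOf? P e) es)

{-# OPTIONS --safe #-}
module Submission where

open import Defs renaming (sym to symmetry)
open import Data.Nat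
  using (ℕ; zero; suc; _+_; _*_; _∸_; _≤_; _<_; _≤?_; _≤ᵇ_; ∣_-_∣; z≤n; s≤s; s≤s⁻¹)
open import Data.Nat.Properties
open import Data.Nat.Divisibility
  using (_∣_; ∣m+n∣m⇒∣n; ∣m∣n⇒∣m+n; m∣m*n; ∣-refl; m%n≡0⇒n∣m; n∣m⇒m%n≡0)
open import Data.Bool using (Bool; true; false; _∧_; _∨_; not; if_then_else_; T)
open import Data.Bool.Properties using (T-≡; T-∧; T-∨)
open import Data.Bool.ListAction using (all)
open import Data.Product using (_×_; _,_; proj₁; proj₂)
open import Data.Product.Properties using (≡-dec)
open import Data.Sum using (_⊎_; inj₁; inj₂)
open import Data.Empty using (⊥; ⊥-elim)
open import Data.List
  using (List; []; _∷_; _++_; map; length; lookup; filter; filterᵇ; cartesianProduct; allFin)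
open import Data.List.Properties using (map-∘)
open import Data.List.Membership.Propositional using (_∈_)
open import Data.List.Membership.DecPropositional using () renaming (_∈?_ to mem?)
open import Data.List.Relation.Unary.All using (universal)
open import Data.List.Relation.Unary.All.Properties using (all⁻)
open import Data.List.Relation.Unary.Any using (here; there; index)
open import Data.List.Relation.Unary.Any.Properties using (lookup-index)
open import Data.Vec as Vec using (Vec)
open import Data.Vec.Properties using (lookup∘tabulate)
open import Data.Fin using (Fin; toℕ; combine; remQuot)
open import Data.Fin.Patterns using (0F; 1F; 2F)
open import Data.Fin.Properties using (toℕ-injective; toℕ≤pred[n]; remQuot-combine)
  renaming (_≟_ to _≟ᶠ_)
open import Function using (_∘_; _⇔_; mk⇔; Equivalence)
open import Function.Definitions using (Injective)
open import Relation.Unary using (Pred; Decidable)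
open import Relation.Nullary using (¬_; Dec; yes; no; ¬?; _×-dec_)
open import Relation.Nullary.Decidable using (isYes; isNo; T?; toWitness; fromWitness; fromWitnessFalse)
open import Relation.Binary.PropositionalEquality
  using (_≡_; _≢_; refl; sym; trans; cong; cong₂; subst; subst₂; module ≡-Reasoning)

-- Along a snake path, adjacent cells have consecutive positions and nonadjacent cells do
-- not. Hence no three cells of P are pairwise adjacent, and no cell of P has three
-- neighbours on P. Every block lies in a 3 × 3 window, the image of [0;2]^2 under a
-- translation followed by a symmetry of A; both preserve king adjacency, and since n - 1
-- is even the symmetry also preserves having an even coordinate, which confines the odd
-- cells of the block to known window positions. An edge of the block is an edge of P
-- only if both its ends lie on P, so w(β) is bounded by a count that depends only on
-- which window cells lie on P, and the bounds follow by checking all 2^9 subsets of the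
-- window that contain neither a triangle nor a claw.

Consecutive : ℕ → ℕ → Set
Consecutive i j = j ≡ suc i ⊎ i ≡ suc j

¬consecutive-triangle : ∀ {i j k} → Consecutive i j → Consecutive j k → Consecutive i k → ⊥
¬consecutive-triangle (inj₁ refl) (inj₁ refl) (inj₁ ())
¬consecutive-triangle (inj₁ refl) (inj₁ refl) (inj₂ ())
¬consecutive-triangle (inj₁ refl) (inj₂ refl) (inj₁ ())
¬consecutive-triangle (inj₁ refl) (inj₂ refl) (inj₂ ())
¬consecutive-triangle (inj₂ refl) (inj₁ refl) (inj₁ ())
¬consecutive-triangle (inj₂ refl) (inj₁ refl) (inj₂ ())
¬consecutive-triangle (inj₂ refl) (inj₂ refl) (inj₁ ())
¬consecutive-triangle (inj₂ refl) (inj₂ refl) (inj₂ ())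

consecutive-pigeonhole : ∀ {i a b c} → Consecutive i a → Consecutive i b → Consecutive i c →
                         a ≡ b ⊎ a ≡ c ⊎ b ≡ c
consecutive-pigeonhole (inj₁ refl) (inj₁ refl) _           = inj₁ refl
consecutive-pigeonhole (inj₂ refl) (inj₂ refl) _           = inj₁ refl
consecutive-pigeonhole (inj₁ refl) (inj₂ _)    (inj₁ refl) = inj₂ (inj₁ refl)
consecutive-pigeonhole (inj₁ _)    (inj₂ refl) (inj₂ refl) = inj₂ (inj₂ refl)
consecutive-pigeonhole (inj₂ refl) (inj₁ _)    (inj₂ refl) = inj₂ (inj₁ refl)
consecutive-pigeonhole (inj₂ _)    (inj₁ refl) (inj₁ refl) = inj₂ (inj₂ refl)

module SnakePathProperties {n : ℕ} {P : List Cell} (S : SnakePath n P) where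
  open SnakePath S

  private
    position : ∀ {u} → u ∈ P → ℕ
    position = toℕ ∘ index

    adjacent⇒consecutive : ∀ {u v} (u∈P : u ∈ P) (v∈P : v ∈ P) → Adj u v →
                           Consecutive (position u∈P) (position v∈P)
    adjacent⇒consecutive u∈P v∈P uv =
      adj⇒consec (index u∈P) (index v∈P) (subst₂ Adj (lookup-index u∈P) (lookup-index v∈P) uv)

    position-injective : ∀ {u v} (u∈P : u ∈ P) (v∈P : v ∈ P) → position u∈P ≡ position v∈P → u ≡ v
    position-injective u∈P v∈P eq =
      trans (lookup-index u∈P) (trans (cong (lookup P) (toℕ-injective eq)) (sym (lookup-index v∈P)))

  no-triangle : ∀ {u v w} → u ∈ P → v ∈ P → w ∈ P → Adj u v → Adj v w → Adj u w → ⊥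
  no-triangle u∈P v∈P w∈P uv vw uw =
    ¬consecutive-triangle (adjacent⇒consecutive u∈P v∈P uv) (adjacent⇒consecutive v∈P w∈P vw)
                          (adjacent⇒consecutive u∈P w∈P uw)

  no-claw : ∀ {v u₁ u₂ u₃} → v ∈ P → u₁ ∈ P → u₂ ∈ P → u₃ ∈ P →
            Adj v u₁ → Adj v u₂ → Adj v u₃ → u₁ ≢ u₂ → u₁ ≢ u₃ → u₂ ≢ u₃ → ⊥
  no-claw v∈P u₁∈P u₂∈P u₃∈P vu₁ vu₂ vu₃ u₁≢u₂ u₁≢u₃ u₂≢u₃
    with consecutive-pigeonhole (adjacent⇒consecutive v∈P u₁∈P vu₁) (adjacent⇒consecutive v∈P u₂∈P vu₂)
                                (adjacent⇒consecutive v∈P u₃∈P vu₃)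
  ... | inj₁ eq        = u₁≢u₂ (position-injective u₁∈P u₂∈P eq)
  ... | inj₂ (inj₁ eq) = u₁≢u₃ (position-injective u₁∈P u₃∈P eq)
  ... | inj₂ (inj₂ eq) = u₂≢u₃ (position-injective u₂∈P u₃∈P eq)

∈-pathEdges⇒∈ : ∀ {P : List Cell} {u v} → (u , v) ∈ pathEdges P → u ∈ P × v ∈ P
∈-pathEdges⇒∈ {_ ∷ _ ∷ _} (here refl) = here refl , there (here refl)
∈-pathEdges⇒∈ {_ ∷ _ ∷ _} (there uv∈) =
  let u∈ , v∈ = ∈-pathEdges⇒∈ uv∈ in there u∈ , there v∈

EdgeOf⇒∈ : ∀ {P : List Cell} {u v} → EdgeOf P (u , v) → u ∈ P × v ∈ P
EdgeOf⇒∈ (inj₁ uv∈) = ∈-pathEdges⇒∈ uv∈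
EdgeOf⇒∈ (inj₂ vu∈) = let v∈ , u∈ = ∈-pathEdges⇒∈ vu∈ in u∈ , v∈

-- Isometries of the king graph

adj? : (u v : Cell) → Dec (Adj u v)
adj? (x , y) (x' , y') = ¬? ((x , y) ≟c (x' , y')) ×-dec (∣ x - x' ∣ ≤? 1) ×-dec (∣ y - y' ∣ ≤? 1)

infixl 6 _⊕_

_⊕_ : Cell → Cell → Cell
(a , b) ⊕ (x , y) = a + x , b + y

⊕-cancelˡ : ∀ w {u v} → w ⊕ u ≡ w ⊕ v → u ≡ v
⊕-cancelˡ (a , b) eq = cong₂ _,_ (+-cancelˡ-≡ a _ _ (cong proj₁ eq)) (+-cancelˡ-≡ b _ _ (cong proj₂ eq))

Adj-⊕ : ∀ w {u v} → Adj u v → Adj (w ⊕ u) (w ⊕ v)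
Adj-⊕ w@(a , b) {x , y} {x' , y'} (u≢v , dx , dy) =
  u≢v ∘ ⊕-cancelˡ w ,
  subst (_≤ 1) (sym (∣m+n-m+o∣≡∣n-o∣ a x x')) dx ,
  subst (_≤ 1) (sym (∣m+n-m+o∣≡∣n-o∣ b y y')) dy

∣m∸a-m∸b∣≡∣a-b∣ : ∀ {m a b} → a ≤ m → b ≤ m → ∣ m ∸ a - m ∸ b ∣ ≡ ∣ a - b ∣
∣m∸a-m∸b∣≡∣a-b∣ {m} {a} {b} a≤m b≤m = begin
  ∣ m ∸ a - m ∸ b ∣                   ≡⟨ ∣m+n-m+o∣≡∣n-o∣ b (m ∸ a) (m ∸ b) ⟨
  ∣ b + (m ∸ a) - b + (m ∸ b) ∣       ≡⟨ cong₂ ∣_-_∣ (+-comm b (m ∸ a)) (m+[n∸m]≡n b≤m) ⟩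
  ∣ m ∸ a + b - m ∣                   ≡⟨ cong (∣ m ∸ a + b -_∣) (m∸n+n≡m a≤m) ⟨
  ∣ m ∸ a + b - m ∸ a + a ∣           ≡⟨ ∣m+n-m+o∣≡∣n-o∣ (m ∸ a) b a ⟩
  ∣ b - a ∣                           ≡⟨ ∣-∣-comm b a ⟩
  ∣ a - b ∣                           ∎
  where open ≡-Reasoning

-- applySym n π acts on each coordinate (after the optional swap) as reflectIf (n ∸ 1).
reflectIf : ℕ → Bool → ℕ → ℕ
reflectIf m reflect a = if reflect then m ∸ a else a

reflectIf-∣-∣ : ∀ {m a b} reflect → a ≤ m → b ≤ m →
                ∣ reflectIf m reflect a - reflectIf m reflect b ∣ ≡ ∣ a - b ∣
reflectIf-∣-∣ false _   _   = refl
reflectIf-∣-∣ true  a≤m b≤m = ∣m∸a-m∸b∣≡∣a-b∣ a≤m b≤m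

reflectIf-injective : ∀ {m a b} reflect → a ≤ m → b ≤ m →
                      reflectIf m reflect a ≡ reflectIf m reflect b → a ≡ b
reflectIf-injective reflect a≤m b≤m eq =
  ∣m-n∣≡0⇒m≡n (trans (sym (reflectIf-∣-∣ reflect a≤m b≤m)) (m≡n⇒∣m-n∣≡0 eq))

reflectIf-even : ∀ {m a} reflect → 2 ∣ m → a ≤ m → 2 ∣ a → 2 ∣ reflectIf m reflect a
reflectIf-even false _   _   2∣a = 2∣a
reflectIf-even true  2∣m a≤m 2∣a = ∣m+n∣m⇒∣n (subst (2 ∣_) (sym (m+[n∸m]≡n a≤m)) 2∣m) 2∣a

HasEvenCoordinate : Cell → Set
HasEvenCoordinate (x , y) = 2 ∣ x ⊎ 2 ∣ y

HasEvenCoordinate⇒¬OddCell : ∀ {c} → HasEvenCoordinate c → ¬ OddCell c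
HasEvenCoordinate⇒¬OddCell {x , _} (inj₁ 2∣x) (x%2≡1 , _) =
  0≢1+n (trans (sym (n∣m⇒m%n≡0 x 2 2∣x)) x%2≡1)
HasEvenCoordinate⇒¬OddCell {_ , y} (inj₂ 2∣y) (_ , y%2≡1) =
  0≢1+n (trans (sym (n∣m⇒m%n≡0 y 2 2∣y)) y%2≡1)

InSquare : ℕ → Cell → Set
InSquare m (x , y) = x ≤ m × y ≤ m

module _ (n : ℕ) where
  private
    m : ℕ
    m = n ∸ 1

  applySym-injective : ∀ π {u v} → InSquare m u → InSquare m v → applySym n π u ≡ applySym n π v → u ≡ v
  applySym-injective (symmetry false rx ry) (x≤ , y≤) (x'≤ , y'≤) eq =
    cong₂ _,_ (reflectIf-injective rx x≤ x'≤ (cong proj₁ eq)) (reflectIf-injective ry y≤ y'≤ (cong proj₂ eq))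
  applySym-injective (symmetry true rx ry) (x≤ , y≤) (x'≤ , y'≤) eq =
    cong₂ _,_ (reflectIf-injective ry x≤ x'≤ (cong proj₂ eq)) (reflectIf-injective rx y≤ y'≤ (cong proj₁ eq))

  applySym-Adj : ∀ π {u v} → InSquare m u → InSquare m v → Adj u v → Adj (applySym n π u) (applySym n π v)
  applySym-Adj π@(symmetry false rx ry) u□@(x≤ , y≤) v□@(x'≤ , y'≤) (u≢v , dx , dy) =
    u≢v ∘ applySym-injective π u□ v□ ,
    subst (_≤ 1) (sym (reflectIf-∣-∣ rx x≤ x'≤)) dx ,
    subst (_≤ 1) (sym (reflectIf-∣-∣ ry y≤ y'≤)) dy
  applySym-Adj π@(symmetry true rx ry) u□@(x≤ , y≤) v□@(x'≤ , y'≤) (u≢v , dx , dy) =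
    u≢v ∘ applySym-injective π u□ v□ ,
    subst (_≤ 1) (sym (reflectIf-∣-∣ rx y≤ y'≤)) dy ,
    subst (_≤ 1) (sym (reflectIf-∣-∣ ry x≤ x'≤)) dx

  applySym-HasEvenCoordinate : ∀ π {u} → 2 ∣ m → InSquare m u → HasEvenCoordinate u →
                               HasEvenCoordinate (applySym n π u)
  applySym-HasEvenCoordinate (symmetry false rx ry) 2∣m (x≤ , _) (inj₁ 2∣x) =
    inj₁ (reflectIf-even rx 2∣m x≤ 2∣x)
  applySym-HasEvenCoordinate (symmetry false rx ry) 2∣m (_ , y≤) (inj₂ 2∣y) =
    inj₂ (reflectIf-even ry 2∣m y≤ 2∣y)
  applySym-HasEvenCoordinate (symmetry true  rx ry) 2∣m (x≤ , _) (inj₁ 2∣x) =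
    inj₂ (reflectIf-even ry 2∣m x≤ 2∣x)
  applySym-HasEvenCoordinate (symmetry true  rx ry) 2∣m (_ , y≤) (inj₂ 2∣y) =
    inj₁ (reflectIf-even rx 2∣m y≤ 2∣y)

Pos : Set
Pos = Fin 3 × Fin 3

coords : Pos → Cell
coords (i , j) = toℕ i , toℕ j

WindowAdj : Pos → Pos → Set
WindowAdj p q = Adj (coords p) (coords q)

record WindowEmbedding (e : Pos → Cell) : Set where
  field
    adj       : ∀ {p q} → WindowAdj p q → Adj (e p) (e q)
    injective : Injective _≡_ _≡_ e

Run : (Fin 3 → ℕ) → Set
Run g = ∀ i → g i ≡ g 0F + toℕ i

Run-≤ : ∀ {g m} → Run g → g 2F ≤ m → ∀ i → g i ≤ m
Run-≤ {g} {m} run g₂≤m i = begin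
  g i           ≡⟨ run i ⟩
  g 0F + toℕ i  ≤⟨ +-monoʳ-≤ (g 0F) (toℕ≤pred[n] i) ⟩
  g 0F + 2      ≡⟨ run 2F ⟨
  g 2F          ≤⟨ g₂≤m ⟩
  m             ∎
  where open ≤-Reasoning

place : (Fin 3 → ℕ) → (Fin 3 → ℕ) → Pos → Cell
place g h (i , j) = g i , h j

module _ {g h : Fin 3 → ℕ} (g-run : Run g) (h-run : Run h) where
  private
    place≡⊕ : ∀ p → place g h p ≡ (g 0F , h 0F) ⊕ coords p
    place≡⊕ (i , j) = cong₂ _,_ (g-run i) (h-run j)

  place-embedding : WindowEmbedding (place g h)
  place-embedding = record
    { adj       = λ {p} {q} pq → subst₂ Adj (sym (place≡⊕ p)) (sym (place≡⊕ q)) (Adj-⊕ (g 0F , h 0F) pq)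
    ; injective = λ {p} {q} eq → coords-injective (⊕-cancelˡ (g 0F , h 0F)
                    (trans (sym (place≡⊕ p)) (trans eq (place≡⊕ q))))
    }
    where
    coords-injective : ∀ {p q} → coords p ≡ coords q → p ≡ q
    coords-injective eq = cong₂ _,_ (toℕ-injective (cong proj₁ eq)) (toℕ-injective (cong proj₂ eq))

applySym-embedding : ∀ n π {e} → (∀ p → InSquare (n ∸ 1) (e p)) → WindowEmbedding e →
                     WindowEmbedding (applySym n π ∘ e)
applySym-embedding n π e□ E = record
  { adj       = λ {p} {q} pq → applySym-Adj n π (e□ p) (e□ q) (adj pq)
  ; injective = λ {p} {q} eq → injective (applySym-injective n π (e□ p) (e□ q) eq)
  }
  where open WindowEmbedding E

-- Exhaustive check over the configurations of a window

Config : Set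
Config = Pos → Bool

_≟ₚ_ : (p q : Pos) → Dec (p ≡ q)
_≟ₚ_ = ≡-dec _≟ᶠ_ _≟ᶠ_

windowAdj? : ∀ p q → Dec (WindowAdj p q)
windowAdj? p q = adj? (coords p) (coords q)

Triangle : Config → Pos × Pos × Pos → Set
Triangle β (p , q , r) = T (β p) × T (β q) × T (β r) × WindowAdj p q × WindowAdj q r × WindowAdj p r

Claw : Config → Pos × Pos × Pos × Pos → Set
Claw β (v , u₁ , u₂ , u₃) =
  T (β v) × T (β u₁) × T (β u₂) × T (β u₃) × WindowAdj v u₁ × WindowAdj v u₂ × WindowAdj v u₃ ×
  u₁ ≢ u₂ × u₁ ≢ u₃ × u₂ ≢ u₃

triangle? : ∀ β t → Dec (Triangle β t)
triangle? β (p , q , r) =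
  T? (β p) ×-dec T? (β q) ×-dec T? (β r) ×-dec windowAdj? p q ×-dec windowAdj? q r ×-dec windowAdj? p r

claw? : ∀ β c → Dec (Claw β c)
claw? β (v , u₁ , u₂ , u₃) =
  T? (β v) ×-dec T? (β u₁) ×-dec T? (β u₂) ×-dec T? (β u₃) ×-dec
  windowAdj? v u₁ ×-dec windowAdj? v u₂ ×-dec windowAdj? v u₃ ×-dec
  ¬? (u₁ ≟ₚ u₂) ×-dec ¬? (u₁ ≟ₚ u₃) ×-dec ¬? (u₂ ≟ₚ u₃)

admissibleOn : List (Pos × Pos × Pos) → List (Pos × Pos × Pos × Pos) → Config → Bool
admissibleOn ts cs β = all (isNo ∘ triangle? β) ts ∧ all (isNo ∘ claw? β) cs

admissibleOn-sound : ∀ ts cs {β} → (∀ t → ¬ Triangle β t) → (∀ c → ¬ Claw β c) →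
                     T (admissibleOn ts cs β)
admissibleOn-sound ts cs {β} ¬triangle ¬claw = Equivalence.from T-∧
  ( all⁻ (isNo ∘ triangle? β) (universal (fromWitnessFalse ∘ ¬triangle) ts)
  , all⁻ (isNo ∘ claw? β) (universal (fromWitnessFalse ∘ ¬claw) cs) )

positions : List Pos
positions = cartesianProduct (allFin 3) (allFin 3)

pairs : ∀ {A : Set} → List A → List (A × A)
pairs []       = []
pairs (x ∷ xs) = map (x ,_) xs ++ pairs xs

triples : ∀ {A : Set} → List A → List (A × A × A)
triples []       = []
triples (x ∷ xs) = map (x ,_) (pairs xs) ++ triples xs

full : Config
full _ = true

windowTriangles : List (Pos × Pos × Pos)
windowTriangles = filter (triangle? full) (triples positions)

windowClaws : List (Pos × Pos × Pos × Pos)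
windowClaws = filter (claw? full) (cartesianProduct positions (triples positions))

oddCount : (Pos → Bool) → Config → List Pos → ℕ
oddCount mayBeOdd β vs = length (filterᵇ (λ p → mayBeOdd p ∧ β p) vs)

edgeCount : Config → List (Pos × Pos) → ℕ
edgeCount β es = length (filterᵇ (λ (p , q) → β p ∧ β q) es)

bits : Config → Vec Bool 9
bits β = Vec.tabulate (β ∘ remQuot 3)

fromBits : Vec Bool 9 → Config
fromBits bs (i , j) = Vec.lookup bs (combine i j)

fromBits-bits : ∀ β p → fromBits (bits β) p ≡ β p
fromBits-bits β (i , j) = trans (lookup∘tabulate (β ∘ remQuot 3) (combine i j)) (cong β (remQuot-combine i j))

allVecs : ∀ k → (Vec Bool k → Bool) → Bool
allVecs zero    h = h Vec.[]
allVecs (suc k) h = allVecs k (h ∘ (true Vec.∷_)) ∧ allVecs k (h ∘ (false Vec.∷_))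

allVecs-sound : ∀ k {h} → T (allVecs k h) → ∀ bs → T (h bs)
allVecs-sound zero        t Vec.[]           = t
allVecs-sound (suc k)     t (true Vec.∷ bs)  = allVecs-sound k (proj₁ (Equivalence.to T-∧ t)) bs
allVecs-sound (suc k) {h} t (false Vec.∷ bs) =
  allVecs-sound k (proj₂ (Equivalence.to (T-∧ {allVecs k (h ∘ (true Vec.∷_))}) t)) bs

boundedAt : List (Pos × Pos × Pos) → List (Pos × Pos × Pos × Pos) →
            (Pos → Bool) → List Pos → List (Pos × Pos) → ℕ → Vec Bool 9 → Bool
boundedAt ts cs mayBeOdd vs es b bs =
  not (admissibleOn ts cs (fromBits bs)) ∨ (oddCount mayBeOdd (fromBits bs) vs + edgeCount (fromBits bs) es ≤ᵇ b)

BoundedOn : List (Pos × Pos × Pos) → List (Pos × Pos × Pos × Pos) →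
            (Pos → Bool) → List Pos → List (Pos × Pos) → ℕ → Bool
BoundedOn ts cs mayBeOdd vs es b = allVecs 9 (boundedAt ts cs mayBeOdd vs es b)

-- The candidate lists are passed as arguments so that evaluation computes them once
-- and shares them among all 2^9 configurations.
Bounded : (Pos → Bool) → List Pos → List (Pos × Pos) → ℕ → Bool
Bounded = BoundedOn windowTriangles windowClaws

BoundedOn-sound : ∀ ts cs {mayBeOdd vs es b} → BoundedOn ts cs mayBeOdd vs es b ≡ true →
                  ∀ bs → T (admissibleOn ts cs (fromBits bs)) →
                  oddCount mayBeOdd (fromBits bs) vs + edgeCount (fromBits bs) es ≤ b
BoundedOn-sound ts cs {mayBeOdd} {vs} {es} {b} bounded bs =
  ≤ᵇ⇒≤ _ _ ∘ modus-ponens (admissibleOn ts cs (fromBits bs))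
                          (allVecs-sound 9 {boundedAt ts cs mayBeOdd vs es b} (Equivalence.from T-≡ bounded) bs)
  where
  modus-ponens : ∀ a {c} → T (not a ∨ c) → T a → T c
  modus-ponens true t _ = t

-- The trace of a snake path on a window

length-filter-map-≤ : ∀ {a b p} {A : Set a} {B : Set b} {Q : Pred B p} (Q? : Decidable Q) (f : A → B)
                      (q : A → Bool) → (∀ x → Q (f x) → T (q x)) →
                      ∀ xs → length (filter Q? (map f xs)) ≤ length (filterᵇ q xs)
length-filter-map-≤ Q? f q Q⇒q [] = z≤n
length-filter-map-≤ Q? f q Q⇒q (x ∷ xs) with Q? (f x) | q x | Q⇒q x
... | yes _   | true  | _    = s≤s (length-filter-map-≤ Q? f q Q⇒q xs)
... | yes Qfx | false | Qfx⇒ = ⊥-elim (Qfx⇒ Qfx)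
... | no _    | true  | _    = m≤n⇒m≤1+n (length-filter-map-≤ Q? f q Q⇒q xs)
... | no _    | false | _    = length-filter-map-≤ Q? f q Q⇒q xs

module WindowOfSnakePath {n : ℕ} {P : List Cell} (S : SnakePath n P) {e : Pos → Cell} (E : WindowEmbedding e) where
  open SnakePathProperties S
  open WindowEmbedding E

  on-path : Config
  on-path p = isYes (mem? _≟c_ (e p) P)

  trace : Config
  trace = fromBits (bits on-path)

  trace-∈ : ∀ {p} → T (trace p) ⇔ e p ∈ P
  trace-∈ {p} = subst (λ b → T b ⇔ e p ∈ P) (sym (fromBits-bits on-path p))
                      (mk⇔ toWitness fromWitness)

  trace-admissible : ∀ ts cs → T (admissibleOn ts cs trace)
  trace-admissible ts cs = admissibleOn-sound ts cs no-traced-triangle no-traced-claw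
    where
    on-P : ∀ {p} → T (trace p) → e p ∈ P
    on-P = Equivalence.to trace-∈

    no-traced-triangle : ∀ t → ¬ Triangle trace t
    no-traced-triangle _ (p∈ , q∈ , r∈ , pq , qr , pr) =
      no-triangle (on-P p∈) (on-P q∈) (on-P r∈) (adj pq) (adj qr) (adj pr)

    no-traced-claw : ∀ c → ¬ Claw trace c
    no-traced-claw _ (v∈ , u₁∈ , u₂∈ , u₃∈ , vu₁ , vu₂ , vu₃ , u₁≢u₂ , u₁≢u₃ , u₂≢u₃) =
      no-claw (on-P v∈) (on-P u₁∈) (on-P u₂∈) (on-P u₃∈) (adj vu₁) (adj vu₂) (adj vu₃)
              (u₁≢u₂ ∘ injective) (u₁≢u₃ ∘ injective) (u₂≢u₃ ∘ injective)

  weight-≤-counts : ∀ {mayBeOdd} → (∀ p → OddCell (e p) → T (mayBeOdd p)) → ∀ vs es →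
                    weight P (sg (map e vs) (map (λ (p , q) → e p , e q) es))
                      ≤ oddCount mayBeOdd trace vs + edgeCount trace es
  weight-≤-counts {mayBeOdd} odd-marked vs es =
    +-mono-≤ (length-filter-map-≤ _ e _ odd-on-path vs) (length-filter-map-≤ _ _ _ edge-on-path es)
    where
    on-trace : ∀ {p} → e p ∈ P → T (trace p)
    on-trace = Equivalence.from trace-∈

    odd-on-path : ∀ p → OddCell (e p) × e p ∈ P → T (mayBeOdd p ∧ trace p)
    odd-on-path p (odd , p∈) = Equivalence.from T-∧ (odd-marked p odd , on-trace p∈)

    edge-on-path : ∀ ((p , q) : Pos × Pos) → Regular (e p , e q) × EdgeOf P (e p , e q) →
                   T (trace p ∧ trace q)
    edge-on-path _ (_ , pq) = let p∈ , q∈ = EdgeOf⇒∈ pq in Equivalence.from T-∧ (on-trace p∈ , on-trace q∈)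

  weight-≤ : ∀ {mayBeOdd b} vs es → (∀ p → OddCell (e p) → T (mayBeOdd p)) →
             Bounded mayBeOdd vs es b ≡ true →
             weight P (sg (map e vs) (map (λ (p , q) → e p , e q) es)) ≤ b
  weight-≤ {mayBeOdd} {b} vs es odd-marked bounded =
    ≤-trans (weight-≤-counts odd-marked vs es)
            (BoundedOn-sound windowTriangles windowClaws {mayBeOdd} {vs} {es} {b} bounded (bits on-path)
                             (trace-admissible windowTriangles windowClaws))

¬T⇒T-not : ∀ {b} → ¬ T b → T (not b)
¬T⇒T-not {false} _  = _
¬T⇒T-not {true}  ¬t = ¬t _

placeWindow : (Fin 3 → ℕ) → (Fin 3 → ℕ) → List Pos → List (Pos × Pos) → Subgraph
placeWindow g h vs es = sg (map (place g h) vs) (map (λ (p , q) → place g h p , place g h q) es)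

mayBeOdd : (Fin 3 → Bool) → (Fin 3 → Bool) → Pos → Bool
mayBeOdd evenColumn evenRow (i , j) = not (evenColumn i ∨ evenRow j)

module SymmetricWindow {n : ℕ} {P : List Cell} (S : SnakePath n P) (2∣n∸1 : 2 ∣ n ∸ 1) (π : Sym)
                       {g h : Fin 3 → ℕ} (g-run : Run g) (h-run : Run h)
                       (g₂≤ : g 2F ≤ n ∸ 1) (h₂≤ : h 2F ≤ n ∸ 1) where
  in-square : ∀ p → InSquare (n ∸ 1) (place g h p)
  in-square (i , j) = Run-≤ g-run g₂≤ i , Run-≤ h-run h₂≤ j

  open WindowOfSnakePath S (applySym-embedding n π in-square (place-embedding g-run h-run))

  mayBeOdd-marks : ∀ {evenColumn evenRow} →
                   (∀ i → T (evenColumn i) → 2 ∣ g i) → (∀ j → T (evenRow j) → 2 ∣ h j) →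
                   ∀ p → OddCell (applySym n π (place g h p)) → T (mayBeOdd evenColumn evenRow p)
  mayBeOdd-marks {evenColumn} {evenRow} g-even h-even (i , j) odd = ¬T⇒T-not λ even →
    HasEvenCoordinate⇒¬OddCell
      (applySym-HasEvenCoordinate n π 2∣n∸1 (in-square (i , j)) (even-coordinate (Equivalence.to T-∨ even)))
      odd
    where
    even-coordinate : T (evenColumn i) ⊎ T (evenRow j) → HasEvenCoordinate (g i , h j)
    even-coordinate (inj₁ column) = inj₁ (g-even i column)
    even-coordinate (inj₂ row)    = inj₂ (h-even j row)

  window-weight-≤ : ∀ {evenColumn evenRow b} vs es →
                    (∀ i → T (evenColumn i) → 2 ∣ g i) → (∀ j → T (evenRow j) → 2 ∣ h j) →
                    Bounded (mayBeOdd evenColumn evenRow) vs es b ≡ true →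
                    weight P (imageSG n π (placeWindow g h vs es)) ≤ b
  window-weight-≤ {evenColumn} {evenRow} {b} vs es g-even h-even bounded =
    subst (λ G → weight P G ≤ b) (cong₂ sg (map-∘ vs) (map-∘ es))
          (weight-≤ {mayBeOdd evenColumn evenRow} {b} vs es (mayBeOdd-marks g-even h-even) bounded)

-- The axes are written so that placeWindow reproduces the vertices and edges of littleβ z
-- and largeβ (suc x₀) y definitionally.
littleAxis : ℕ → Fin 3 → ℕ
littleAxis z 0F = z
littleAxis z 1F = suc z
littleAxis z 2F = suc (suc z)

littleAxis-run : ∀ z → Run (littleAxis z)
littleAxis-run z 0F = sym (+-identityʳ z)
littleAxis-run z 1F = sym (+-comm z 1)
littleAxis-run z 2F = sym (+-comm z 2)

isFirst : Fin 3 → Bool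
isFirst 0F = true
isFirst _  = false

littleAxis-even : ∀ {z} → 2 ∣ z → ∀ i → T (isFirst i) → 2 ∣ littleAxis z i
littleAxis-even 2∣z 0F _ = 2∣z

littleVertices : List Pos
littleVertices = (0F , 0F) ∷ (0F , 1F) ∷ (1F , 0F) ∷ (1F , 1F) ∷ []

littleEdges : List (Pos × Pos)
littleEdges = ((0F , 0F) , (0F , 1F)) ∷ ((0F , 0F) , (1F , 0F)) ∷ ((0F , 1F) , (1F , 0F)) ∷ []

little-bounded : Bounded (mayBeOdd isFirst isFirst) littleVertices littleEdges 1 ≡ true
little-bounded = refl

largeColumns : ℕ → Fin 3 → ℕ
largeColumns x₀ 0F = x₀
largeColumns x₀ 1F = suc x₀
largeColumns x₀ 2F = suc x₀ + 1

largeColumns-run : ∀ x₀ → Run (largeColumns x₀)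
largeColumns-run x₀ 0F = sym (+-identityʳ x₀)
largeColumns-run x₀ 1F = sym (+-comm x₀ 1)
largeColumns-run x₀ 2F = sym (+-suc x₀ 1)

largeRows : ℕ → Fin 3 → ℕ
largeRows y 0F = y
largeRows y 1F = y + 1
largeRows y 2F = y + 2

largeRows-run : ∀ y → Run (largeRows y)
largeRows-run y 0F = sym (+-identityʳ y)
largeRows-run y 1F = refl
largeRows-run y 2F = refl

isMiddle : Fin 3 → Bool
isMiddle 1F = true
isMiddle _  = false

largeColumns-even : ∀ {x₀} → 2 ∣ suc x₀ → ∀ i → T (isMiddle i) → 2 ∣ largeColumns x₀ i
largeColumns-even 2∣x 1F _ = 2∣x

largeRows-even : ∀ {y} → 2 ∣ y → ∀ j → T (not (isMiddle j)) → 2 ∣ largeRows y j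
largeRows-even 2∣y 0F _ = 2∣y
largeRows-even 2∣y 2F _ = ∣m∣n⇒∣m+n 2∣y ∣-refl

largeVertices : List Pos
largeVertices = (0F , 0F) ∷ (1F , 0F) ∷ (2F , 0F) ∷
                (0F , 1F) ∷ (1F , 1F) ∷ (2F , 1F) ∷
                (0F , 2F) ∷ (1F , 2F) ∷ (2F , 2F) ∷ []

largeEdges : List (Pos × Pos)
largeEdges = ((1F , 0F) , (0F , 0F)) ∷ ((1F , 0F) , (2F , 0F)) ∷
             ((1F , 1F) , (0F , 0F)) ∷ ((1F , 1F) , (1F , 0F)) ∷ ((1F , 1F) , (2F , 0F)) ∷
             ((1F , 1F) , (0F , 2F)) ∷ ((1F , 1F) , (1F , 2F)) ∷ ((1F , 1F) , (2F , 2F)) ∷ []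

large-bounded : Bounded (mayBeOdd isMiddle (not ∘ isMiddle)) largeVertices largeEdges 2 ≡ true
large-bounded = refl

2[1+k]∸1≡1+2k : ∀ k → 2 * suc k ∸ 1 ≡ suc (2 * k)
2[1+k]∸1≡1+2k k = +-suc k (k + 0)

little-fits : ∀ {z k} → z + 2 ≤ suc k → suc (suc z) ≤ 2 * k
little-fits {z} {k} z+2≤1+k = begin
  suc (suc z) ≤⟨ s≤s 1+z≤k ⟩
  suc k       ≡⟨ +-comm 1 k ⟩
  k + 1       ≤⟨ +-monoʳ-≤ k (≤-trans (s≤s z≤n) 1+z≤k) ⟩
  k + k       ≡⟨ cong (k +_) (+-identityʳ k) ⟨
  2 * k       ∎
  where
  open ≤-Reasoning
  1+z≤k : suc z ≤ k
  1+z≤k = s≤s⁻¹ (subst (_≤ suc k) (+-comm z 2) z+2≤1+k)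

large-fits : ∀ x y {m} → x + y + 3 ≤ suc m → x + 1 ≤ m × y + 2 ≤ m
large-fits x y {m} x+y+3≤1+m =
  ≤-trans (+-mono-≤ (m≤m+n x y) (n≤1+n 1)) x+y+2≤m , ≤-trans (+-monoˡ-≤ 2 (m≤n+m y x)) x+y+2≤m
  where
  x+y+2≤m : x + y + 2 ≤ m
  x+y+2≤m = s≤s⁻¹ (subst (_≤ suc m) (+-suc (x + y) 2) x+y+3≤1+m)

lemma4 : (k n : ℕ) → 1 ≤ k → n ≡ 2 * k ∸ 1 →
         (P : List Cell) → SnakePath n P →
         ((π : Sym) (z : ℕ) → EvenCell (z , z) → z + 2 ≤ k →
            weight P (imageSG n π (littleβ z)) ≤ 1)
         × ((π : Sym) (x y : ℕ) → EvenCell (x , y) → y < x → x + y + 3 ≤ n →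
            weight P (imageSG n π (largeβ x y)) ≤ 2)
lemma4 (suc k) n _ n≡2k+1∸1 P S with trans n≡2k+1∸1 (2[1+k]∸1≡1+2k k)
... | refl = little , large
  where
  open SymmetricWindow S (m∣m*n k)

  little : (π : Sym) (z : ℕ) → EvenCell (z , z) → z + 2 ≤ suc k →
           weight P (imageSG n π (littleβ z)) ≤ 1
  little π z (z%2≡0 , _) z+2≤1+k =
    window-weight-≤ π (littleAxis-run z) (littleAxis-run z) (little-fits z+2≤1+k) (little-fits z+2≤1+k)
                    littleVertices littleEdges
                    (littleAxis-even 2∣z) (littleAxis-even 2∣z) little-bounded
    where
    2∣z : 2 ∣ z
    2∣z = m%n≡0⇒n∣m z 2 z%2≡0

  large : (π : Sym) (x y : ℕ) → EvenCell (x , y) → y < x → x + y + 3 ≤ n →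
          weight P (imageSG n π (largeβ x y)) ≤ 2
  large π (suc x₀) y (x%2≡0 , y%2≡0) _ x+y+3≤n =
    window-weight-≤ π (largeColumns-run x₀) (largeRows-run y) x+1≤2k y+2≤2k
                    largeVertices largeEdges
                    (largeColumns-even (m%n≡0⇒n∣m (suc x₀) 2 x%2≡0))
                    (largeRows-even (m%n≡0⇒n∣m y 2 y%2≡0))
                    large-bounded
    where
    x+1≤2k : suc x₀ + 1 ≤ 2 * k
    x+1≤2k = proj₁ (large-fits (suc x₀) y x+y+3≤n)
    y+2≤2k : y + 2 ≤ 2 * k
    y+2≤2k = proj₂ (large-fits (suc x₀) y x+y+3≤n)
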